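{- If $L=(X,\leq)$ is a finite distributive lattice, then for each meet-irreducible $m$ of $L$ the system $\mathcal{E}(m)$ has a solution in non-negative integers.
   Context: $\mathbf{0}$ is the least element of $L$; $x\prec y$ means $y$ covers $x$; $M$ is the set of meet-irreducibles (elements with exactly one upper cover), $M_x=\{m\in M:x\le m\}$. A finite distributive lattice is upper locally distributive, so for each cover $x\prec y$ the set $M_x\setminus M_y$ has exactly one element $\mathfrak{m}(x,y)$. For $m\in M$, $\mathfrak{U}_m$ is the set of minimal elements of $\{x:\exists y,\ x\prec y,\ \mathfrak{m}(x,y)=m\}$, and $\mathfrak{L}_m$ is the set of maximal elements of $X\setminus\bigcup_{a\in\mathfrak{U}_m}\{x:a\le x\}$. The system $\mathcal{E}(m)$: if $\mathfrak{U}_m=\{\mathbf{0}\}$, it is $w\ge1$; otherwise, in the variables $w$ and $e_x$ for $x\in\bigcup_{a\in\mathfrak{U}_m\cup\mathfrak{L}_m}(M\setminus M_a)$, it consists of $\sum_{x\in M\setminus M_a}e_x<w$ for each $a\in\mathfrak{L}_m$ and $w\le\sum_{x\in M\setminus M_a}e_x$ for each $a\in\mathfrak{U}_m$. -}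

module Defs where

open import Level using (0ℓ)
open import Data.Nat using (ℕ; _≤_; _<_)
open import Data.Fin using (Fin)
open import Data.Fin.Properties using (all?; any?) renaming (_≟_ to _≟F_)
open import Data.List using (List; filter; length; map)
open import Data.Nat.ListAction using (sum)
open import Data.List.Base using (allFin)
open import Data.Product using (Σ; ∃; _×_; _,_)
open import Data.Empty using (⊥)
open import Relation.Nullary using (¬_; Dec; yes; no)
open import Relation.Nullary.Decidable using (_×-dec_; ¬?; _→-dec_)
open import Relation.Binary.Core using (Rel)
open import Relation.Binary.Definitions using (Decidable)
open import Relation.Binary.PropositionalEquality using (_≡_)
open import Algebra.Core using (Op₂)
open import Relation.Binary.Lattice.Structures using (IsDistributiveLattice)
import Data.Nat.Properties as ℕP
open import Function.Bundles using (_⇔_)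

-- A finite distributive lattice L = (X, ≤), presented (up to isomorphism)
-- on the carrier X = Fin n, with equality _≡_.
-- Decidability of the order is included as a field; it is automatic for a
-- finite lattice (x ≤ y iff x ∧ y ≡ x), so it is no restriction.
record FinDistLattice : Set₁ where
  field
    n     : ℕ
    _⊑_   : Rel (Fin n) 0ℓ
    _⊑?_  : Decidable _⊑_
    _∨_   : Op₂ (Fin n)
    _∧_   : Op₂ (Fin n)
    isDistributiveLattice : IsDistributiveLattice _≡_ _⊑_ _∨_ _∧_

module _ (L : FinDistLattice) where
  open FinDistLattice L

  X : Set
  X = Fin n

  _⊏_ : X → X → Set
  x ⊏ y = (x ⊑ y) × ¬ (x ≡ y)

  _⊏?_ : Decidable _⊏_
  x ⊏? y = (x ⊑? y) ×-dec ¬? (x ≟F y)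

  _≺_ : X → X → Set
  x ≺ y = (x ⊏ y) × (∀ z → x ⊏ z → z ⊑ y → z ≡ y)

  _≺?_ : Decidable _≺_
  x ≺? y = (x ⊏? y) ×-dec all? (λ z → (x ⊏? z) →-dec ((z ⊑? y) →-dec (z ≟F y)))

  upperCovers : X → List X
  upperCovers x = filter (x ≺?_) (allFin n)

  IsMI : X → Set
  IsMI x = length (upperCovers x) ≡ 1

  IsMI? : (x : X) → Dec (IsMI x)
  IsMI? x = length (upperCovers x) ℕP.≟ 1

  InMminusMa : X → X → Set
  InMminusMa a x = IsMI x × ¬ (a ⊑ x)

  InMminusMa? : (a x : X) → Dec (InMminusMa a x)
  InMminusMa? a x = IsMI? x ×-dec ¬? (a ⊑? x)

  sumMminusM : X → (X → ℕ) → ℕ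
  sumMminusM a e = sum (map e (filter (InMminusMa? a) (allFin n)))

  -- 𝔪(x,y) = m : for a cover x ≺ y, m is the (unique) element of M_x \ M_y
  LabelIs : X → X → X → Set
  LabelIs x y m = (x ≺ y) × IsMI m × (x ⊑ m) × ¬ (y ⊑ m)

  Src : X → X → Set
  Src m x = ∃ λ y → LabelIs x y m

  InU : X → X → Set
  InU m x = Src m x × (∀ z → Src m z → z ⊑ x → z ≡ x)

  Outside : X → X → Set
  Outside m x = ∀ a → InU m a → ¬ (a ⊑ x)

  InL : X → X → Set
  InL m x = Outside m x × (∀ z → Outside m z → x ⊑ z → z ≡ x)

  IsBottom : X → Set
  IsBottom x = ∀ y → x ⊑ y

  UIsBottom : X → Set
  UIsBottom m = ∀ x → InU m x ⇔ IsBottom x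

  SolvesE : X → ℕ → (X → ℕ) → Set
  SolvesE m w e =
    (∀ a → InL m a → sumMminusM a e < w) ×
    (∀ a → InU m a → w ≤ sumMminusM a e)

  ESolvable : X → Set
  ESolvable m =
    (UIsBottom m → ∃ λ (w : ℕ) → 1 ≤ w) ×
    (¬ UIsBottom m → ∃ λ (w : ℕ) → ∃ λ (e : X → ℕ) → SolvesE m w e)

module Submission where

-- Distributivity makes m meet-prime, so the elements not
-- below m have a least element j, and p = m ∧ j is covered by j with label m.
-- Every cover x ≺ y labelled m has x = m ∧ y ⊒ m ∧ j = p, hence 𝔘_m = {p}; so the
-- region outside ⋃_{a ∈ 𝔘_m} ↑a is X ∖ ↑p, and 𝔏_m is the set of maximal elements
-- of X ∖ ↑p, which are meet-irreducible in any finite lattice.  Put e_x = 1 for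
-- x ∉ ↑p, e_x = 0 otherwise, and w = Σ_{x ∈ M∖M_p} e_x.  The constraint for p ∈ 𝔘_m
-- holds with equality; for a ∈ 𝔏_m every term of Σ_{x ∈ M∖M_a} e_x with non-zero
-- weight also occurs in w, while a itself contributes 1 to w only, so the sum is
-- strictly smaller than w.  If 𝔘_m = {𝟎} the system is just w ≥ 1.

open import Defs renaming (_⊏_ to _⊢_⊏_; _≺_ to _⊢_≺_)
open import Level using (0ℓ)
open import Data.Bool using (if_then_else_)
open import Data.Fin using (Fin)
open import Data.Fin.Induction using (po-wellFounded)
open import Data.Fin.Properties using (any?) renaming (_≟_ to _≟F_)
open import Data.List using (List; []; _∷_; filter; length; map)
open import Data.List.Base using (allFin)
open import Data.List.Membership.Propositional using (_∈_)
open import Data.List.Membership.Propositional.Properties using (∈-filter⁺; ∈-filter⁻; ∈-allFin)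
open import Data.List.Relation.Unary.Any using (here; there)
open import Data.List.Relation.Unary.AllPairs using (_∷_)
open import Data.List.Relation.Unary.All using (_∷_)
open import Data.List.Relation.Unary.Unique.Propositional using (Unique)
open import Data.List.Relation.Unary.Unique.Propositional.Properties using (allFin⁺; filter⁺)
open import Data.Nat using (ℕ; _≤_; _<_; z≤n; s≤s)
open import Data.Nat.ListAction using (sum)
open import Data.Nat.Properties
  using (≤-refl; ≤-trans; ≤-reflexive; <-≤-trans; +-mono-≤; +-monoʳ-≤; +-monoʳ-<; m≤n+m)
open import Data.Product using (∃; _×_; _,_; proj₁; proj₂)
open import Data.Sum using (_⊎_; inj₁; inj₂)
open import Function using (_∘_)
open import Induction.WellFounded using (Acc; acc)
open import Relation.Binary.Core using (Rel)
open import Relation.Binary.Definitions using (Decidable)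
open import Relation.Binary.Structures using (IsPartialOrder)
open import Relation.Binary.Lattice.Bundles using (DistributiveLattice)
open import Relation.Binary.Lattice.Structures using (IsDistributiveLattice)
open import Relation.Binary.PropositionalEquality using (_≡_; refl; sym; trans; subst; cong)
import Relation.Binary.Construct.NonStrictToStrict as NonStrictToStrict
import Relation.Binary.Lattice.Properties.DistributiveLattice as DistributiveLatticeProperties
import Relation.Binary.Lattice.Properties.MeetSemilattice as MeetSemilatticeProperties
open import Relation.Nullary using (¬_; Dec; yes; no; does; contradiction)
open import Relation.Nullary.Decidable using (_×-dec_; ¬?; dec-false)

module WeightedCount {A : Set} {P Q : A → Set}
         (P? : ∀ x → Dec (P x)) (Q? : ∀ x → Dec (Q x)) (e : A → ℕ)
         (P⇒Q : ∀ x → P x → Q x ⊎ e x ≡ 0) where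

  weightZero : ∀ {x} → P x → ¬ Q x → e x ≡ 0
  weightZero {x} px ¬qx with P⇒Q x px
  ... | inj₁ qx = contradiction qx ¬qx
  ... | inj₂ ex≡0 = ex≡0

  count-mono : ∀ xs → sum (map e (filter P? xs)) ≤ sum (map e (filter Q? xs))
  count-mono [] = z≤n
  count-mono (x ∷ xs) with P? x | Q? x
  ... | yes _  | yes _ = +-monoʳ-≤ (e x) (count-mono xs)
  ... | yes px | no ¬qx rewrite weightZero px ¬qx = count-mono xs
  ... | no _   | yes _ = ≤-trans (count-mono xs) (m≤n+m _ (e x))
  ... | no _   | no _ = count-mono xs

  count-strict : ∀ xs {y} → y ∈ xs → Q y → ¬ P y → 0 < e y →
                 sum (map e (filter P? xs)) < sum (map e (filter Q? xs))
  count-strict (x ∷ xs) (here refl) qx ¬px ex>0 with P? x | Q? x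
  ... | yes px | _      = contradiction px ¬px
  ... | no _   | no ¬qx = contradiction qx ¬qx
  ... | no _   | yes _  = +-mono-≤ ex>0 (count-mono xs)
  count-strict (x ∷ xs) (there y∈xs) qy ¬py ey>0 with P? x | Q? x
  ... | yes _  | yes _ = +-monoʳ-< (e x) (count-strict xs y∈xs qy ¬py ey>0)
  ... | yes px | no ¬qx rewrite weightZero px ¬qx = count-strict xs y∈xs qy ¬py ey>0
  ... | no _   | yes _ = <-≤-trans (count-strict xs y∈xs qy ¬py ey>0) (m≤n+m _ (e x))
  ... | no _   | no _ = count-strict xs y∈xs qy ¬py ey>0

length≡1⇒singleton : {A : Set} (xs : List A) → length xs ≡ 1 →
                     ∃ λ c → c ∈ xs × (∀ y → y ∈ xs → y ≡ c)
length≡1⇒singleton (c ∷ []) refl = c , here refl , λ { y (here y≡c) → y≡c }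

singleton⇒length≡1 : {A : Set} (xs : List A) → Unique xs → ∀ {c} → c ∈ xs →
                     (∀ y → y ∈ xs → y ≡ c) → length xs ≡ 1
singleton⇒length≡1 (x ∷ []) _ _ _ = refl
singleton⇒length≡1 (x ∷ y ∷ ys) ((x≢y ∷ _) ∷ _) _ all≡c =
  contradiction (trans (all≡c x (here refl)) (sym (all≡c y (there (here refl))))) x≢y

module FinitePoset {n : ℕ} {_⊑_ : Rel (Fin n) 0ℓ} (_⊑?_ : Decidable _⊑_)
                   (isPartialOrder : IsPartialOrder _≡_ _⊑_) where

  open IsPartialOrder isPartialOrder using () renaming (refl to ⊑-refl; trans to ⊑-trans)
  open NonStrictToStrict _≡_ _⊑_ using (<-decidable) renaming (_<_ to _⊏_)

  Minimal : (Fin n → Set) → Fin n → Set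
  Minimal P x = P x × (∀ w → P w → w ⊑ x → w ≡ x)

  minimalBelow : {P : Fin n → Set} → (∀ x → Dec (P x)) →
                 ∀ z → P z → ∃ λ x → x ⊑ z × Minimal P x
  minimalBelow {P} P? z = descend z (po-wellFounded isPartialOrder z)
    where
    descend : ∀ z → Acc _⊏_ z → P z → ∃ λ x → x ⊑ z × Minimal P x
    descend z (acc below) pz with any? (λ w → P? w ×-dec <-decidable _≟F_ _⊑?_ w z)
    ... | yes (w , pw , w<z) =
      let (x , x⊑w , minimal) = descend w (below w<z) pw
      in x , ⊑-trans x⊑w (proj₁ w<z) , minimal
    ... | no noSmaller = z , ⊑-refl , pz , atMost
      where
      atMost : ∀ w → P w → w ⊑ z → w ≡ z
      atMost w pw w⊑z with w ≟F z
      ... | yes w≡z = w≡z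
      ... | no w≢z = contradiction (w , pw , w⊑z , w≢z) noSmaller

-- Covers and meet-irreducibles in a finite lattice (distributivity is not used here).
module FiniteLattice (L : FinDistLattice) where

  open FinDistLattice L
  open IsDistributiveLattice isDistributiveLattice
    using (isPartialOrder; x≤x∨y; y≤x∨y; x∧y≤x; x∧y≤y; ∧-greatest)
    renaming (refl to ⊑-refl)
  open FinitePoset _⊑?_ isPartialOrder public

  squeeze : ∀ {x y z} → L ⊢ x ≺ y → x ⊑ z → z ⊑ y → ¬ z ≡ y → z ≡ x
  squeeze {x} {z = z} (_ , noneBetween) x⊑z z⊑y z≢y with z ≟F x
  ... | yes z≡x = z≡x
  ... | no z≢x = contradiction (noneBetween z (x⊑z , z≢x ∘ sym) z⊑y) z≢y

  ⊏-∨ : ∀ {x z} → ¬ z ⊑ x → L ⊢ x ⊏ (x ∨ z)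
  ⊏-∨ {x} {z} z⋢x = x≤x∨y x z , λ x≡x∨z → z⋢x (subst (z ⊑_) (sym x≡x∨z) (y≤x∨y x z))

  coverBelow : ∀ {x z} → L ⊢ x ⊏ z → ∃ λ y → L ⊢ x ≺ y × y ⊑ z
  coverBelow {x} {z} x⊏z =
    let (y , y⊑z , x⊏y , minimal) = minimalBelow (_⊏?_ L x) z x⊏z
    in y , (x⊏y , λ w x⊏w w⊑y → minimal w x⊏w w⊑y) , y⊑z

  distinctCovers-meet : ∀ {x y₁ y₂} → L ⊢ x ≺ y₁ → L ⊢ x ≺ y₂ → ¬ y₁ ≡ y₂ → y₁ ∧ y₂ ≡ x
  distinctCovers-meet {x} {y₁} {y₂} x≺y₁ x≺y₂ y₁≢y₂ =
    squeeze x≺y₁ (∧-greatest (proj₁ (proj₁ x≺y₁)) (proj₁ (proj₁ x≺y₂))) (x∧y≤x y₁ y₂) meet≢y₁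
    where
    meet≢y₁ : ¬ y₁ ∧ y₂ ≡ y₁
    meet≢y₁ meet≡y₁ =
      y₁≢y₂ (proj₂ x≺y₂ y₁ (proj₁ x≺y₁) (subst (_⊑ y₂) meet≡y₁ (x∧y≤y y₁ y₂)))

  IsMI⇒uniqueCover : ∀ {m} → IsMI L m → ∃ λ m⁺ → L ⊢ m ≺ m⁺ × (∀ y → L ⊢ m ≺ y → y ≡ m⁺)
  IsMI⇒uniqueCover {m} isMI =
    let (m⁺ , m⁺∈ , all≡m⁺) = length≡1⇒singleton (upperCovers L m) isMI
    in m⁺ , proj₂ (∈-filter⁻ (_≺?_ L m) {xs = allFin n} m⁺∈)
          , λ y m≺y → all≡m⁺ y (∈-filter⁺ (_≺?_ L m) (∈-allFin y) m≺y)

  uniqueCover⇒IsMI : ∀ {a y} → L ⊢ a ≺ y → (∀ y′ → L ⊢ a ≺ y′ → y′ ≡ y) → IsMI L a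
  uniqueCover⇒IsMI {a} {y} a≺y unique =
    singleton⇒length≡1 (upperCovers L a) (filter⁺ (_≺?_ L a) (allFin⁺ n))
      (∈-filter⁺ (_≺?_ L a) (∈-allFin y) a≺y)
      (λ y′ y′∈ → unique y′ (proj₂ (∈-filter⁻ (_≺?_ L a) {xs = allFin n} y′∈)))

  -- A maximal element a of X ∖ ↑p is meet-irreducible: all of its upper covers
  -- lie in ↑p, and two distinct ones would meet in a, forcing p ⊑ a.
  maximalOutside⇒IsMI : ∀ {p a} → ¬ p ⊑ a → (∀ z → ¬ p ⊑ z → a ⊑ z → z ≡ a) → IsMI L a
  maximalOutside⇒IsMI {p} {a} p⋢a maximal =
    let (y₀ , a≺y₀ , _) = coverBelow (⊏-∨ p⋢a)
    in uniqueCover⇒IsMI a≺y₀ (λ y a≺y → unique y y₀ a≺y a≺y₀)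
    where
    coverAbove-p : ∀ {y} → L ⊢ a ≺ y → p ⊑ y
    coverAbove-p {y} ((a⊑y , a≢y) , _) with p ⊑? y
    ... | yes p⊑y = p⊑y
    ... | no p⋢y = contradiction (sym (maximal y p⋢y a⊑y)) a≢y
    unique : ∀ y₁ y₂ → L ⊢ a ≺ y₁ → L ⊢ a ≺ y₂ → y₁ ≡ y₂
    unique y₁ y₂ a≺y₁ a≺y₂ with y₁ ≟F y₂
    ... | yes y₁≡y₂ = y₁≡y₂
    ... | no y₁≢y₂ = contradiction
      (subst (p ⊑_) (distinctCovers-meet a≺y₁ a≺y₂ y₁≢y₂)
        (∧-greatest (coverAbove-p a≺y₁) (coverAbove-p a≺y₂)))
      p⋢a

  outsideWeight : Fin n → Fin n → ℕ
  outsideWeight p x = if does (p ⊑? x) then 0 else 1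

  outsideWeight-outside : ∀ {p x} → ¬ p ⊑ x → 0 < outsideWeight p x
  outsideWeight-outside {p} {x} p⋢x rewrite dec-false (p ⊑? x) p⋢x = s≤s z≤n

  -- Weighting by the indicator of X ∖ ↑p, the weight of M ∖ M_a drops strictly
  -- below that of M ∖ M_p when a is a meet-irreducible outside ↑p: every
  -- x ∈ M ∖ M_a of positive weight lies in M ∖ M_p, and a lies only in the latter.
  weight-drop : ∀ {p a} → IsMI L a → ¬ p ⊑ a →
                sumMminusM L a (outsideWeight p) < sumMminusM L p (outsideWeight p)
  weight-drop {p} {a} isMIa p⋢a =
    count-strict (allFin n) (∈-allFin a) (isMIa , p⋢a) (λ (_ , a⋢a) → a⋢a ⊑-refl)
      (outsideWeight-outside p⋢a)
    where
    inMp-or-weightless : ∀ x → InMminusMa L a x → InMminusMa L p x ⊎ outsideWeight p x ≡ 0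
    inMp-or-weightless x (isMIx , _) with p ⊑? x
    ... | yes _ = inj₂ refl
    ... | no p⋢x = inj₁ (isMIx , p⋢x)
    open WeightedCount (InMminusMa? L a) (InMminusMa? L p) (outsideWeight p) inMp-or-weightless

module MeetIrreducible (L : FinDistLattice) {m : Fin (FinDistLattice.n L)} (isMIm : IsMI L m) where

  open FinDistLattice L
  open IsDistributiveLattice isDistributiveLattice
    using (antisym; ∨-least; x∧y≤x; x∧y≤y; ∧-greatest)
    renaming (refl to ⊑-refl)
  open FiniteLattice L

  distributiveLattice : DistributiveLattice 0ℓ 0ℓ 0ℓ
  distributiveLattice = record { isDistributiveLattice = isDistributiveLattice }

  open DistributiveLatticeProperties distributiveLattice using (∨-distribˡ-∧)
  open MeetSemilatticeProperties (DistributiveLattice.meetSemilattice distributiveLattice)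
    using (∧-monotonic)
  open import Relation.Binary.Reasoning.PartialOrder (DistributiveLattice.poset distributiveLattice)

  uniqueCover : ∃ λ m⁺ → L ⊢ m ≺ m⁺ × (∀ y → L ⊢ m ≺ y → y ≡ m⁺)
  uniqueCover = IsMI⇒uniqueCover isMIm

  m⁺ : Fin n
  m⁺ = proj₁ uniqueCover

  m⁺⋢m : ¬ m⁺ ⊑ m
  m⁺⋢m m⁺⊑m = let ((m⊑m⁺ , m≢m⁺) , _) = proj₁ (proj₂ uniqueCover) in m≢m⁺ (antisym m⊑m⁺ m⁺⊑m)

  m⁺-least : ∀ {z} → L ⊢ m ⊏ z → m⁺ ⊑ z
  m⁺-least m⊏z =
    let (y , m≺y , y⊑z) = coverBelow m⊏z
    in subst (_⊑ _) (proj₂ (proj₂ uniqueCover) y m≺y) y⊑z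

  meetPrime : ∀ {z₁ z₂} → ¬ z₁ ⊑ m → ¬ z₂ ⊑ m → ¬ (z₁ ∧ z₂) ⊑ m
  meetPrime {z₁} {z₂} z₁⋢m z₂⋢m z₁∧z₂⊑m = m⁺⋢m (begin
    m⁺                  ≤⟨ ∧-greatest (m⁺-least (⊏-∨ z₁⋢m)) (m⁺-least (⊏-∨ z₂⋢m)) ⟩
    (m ∨ z₁) ∧ (m ∨ z₂) ≡⟨ sym (∨-distribˡ-∧ m z₁ z₂) ⟩
    m ∨ (z₁ ∧ z₂)       ≤⟨ ∨-least ⊑-refl z₁∧z₂⊑m ⟩
    m                   ∎)

  leastOutside : ∃ λ x → x ⊑ m⁺ × Minimal (λ z → ¬ z ⊑ m) x
  leastOutside = minimalBelow (λ z → ¬? (z ⊑? m)) m⁺ m⁺⋢m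

  j : Fin n
  j = proj₁ leastOutside

  j⋢m : ¬ j ⊑ m
  j⋢m = proj₁ (proj₂ (proj₂ leastOutside))

  j-minimal : ∀ z → ¬ z ⊑ m → z ⊑ j → z ≡ j
  j-minimal = proj₂ (proj₂ (proj₂ leastOutside))

  -- Minimality upgrades to leastness because the complement of ↓m is closed under meets.
  j-least : ∀ {z} → ¬ z ⊑ m → j ⊑ z
  j-least {z} z⋢m = subst (_⊑ z) (j-minimal (j ∧ z) (meetPrime j⋢m z⋢m) (x∧y≤x j z)) (x∧y≤y j z)

  p : Fin n
  p = m ∧ j

  p≺j : L ⊢ p ≺ j
  p≺j = (x∧y≤y m j , λ p≡j → j⋢m (subst (_⊑ m) p≡j (x∧y≤x m j))) , noneBetween
    where
    noneBetween : ∀ z → L ⊢ p ⊏ z → z ⊑ j → z ≡ j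
    noneBetween z (p⊑z , p≢z) z⊑j with z ⊑? m
    ... | yes z⊑m = contradiction (antisym p⊑z (∧-greatest z⊑m z⊑j)) p≢z
    ... | no z⋢m = j-minimal z z⋢m z⊑j

  p∈Src : Src L m p
  p∈Src = j , p≺j , isMIm , x∧y≤x m j , j⋢m

  -- The source x of a cover x ≺ y labelled m equals m ∧ y, and j ⊑ y, so p ⊑ x.
  Src-above-p : ∀ {x} → Src L m x → p ⊑ x
  Src-above-p {x} (y , x≺y , _ , x⊑m , y⋢m) = begin
    m ∧ j ≤⟨ ∧-monotonic ⊑-refl (j-least y⋢m) ⟩
    m ∧ y ≡⟨ squeeze x≺y (∧-greatest x⊑m (proj₁ (proj₁ x≺y))) (x∧y≤y m y) m∧y≢y ⟩
    x     ∎
    where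
    m∧y≢y : ¬ m ∧ y ≡ y
    m∧y≢y m∧y≡y = y⋢m (subst (_⊑ m) m∧y≡y (x∧y≤x m y))

  p∈U : InU L m p
  p∈U = p∈Src , λ z z∈Src z⊑p → antisym z⊑p (Src-above-p z∈Src)

  U≡p : ∀ {u} → InU L m u → u ≡ p
  U≡p (u∈Src , minimal) = sym (minimal p p∈Src (Src-above-p u∈Src))

  InL⇒maximalOutside : ∀ {a} → InL L m a → ¬ p ⊑ a × (∀ z → ¬ p ⊑ z → a ⊑ z → z ≡ a)
  InL⇒maximalOutside (outside , maximal) =
    outside p p∈U , λ z p⋢z → maximal z (λ u u∈U u⊑z → p⋢z (subst (_⊑ z) (U≡p u∈U) u⊑z))

  e : Fin n → ℕ
  e = outsideWeight p

  w : ℕ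
  w = sumMminusM L p e

  solvesE : SolvesE L m w e
  solvesE = lowerConstraints , upperConstraints
    where
    lowerConstraints : ∀ a → InL L m a → sumMminusM L a e < w
    lowerConstraints a a∈L =
      let (p⋢a , maximal) = InL⇒maximalOutside a∈L
      in weight-drop (maximalOutside⇒IsMI p⋢a maximal) p⋢a
    upperConstraints : ∀ a → InU L m a → w ≤ sumMminusM L a e
    upperConstraints a a∈U = ≤-reflexive (cong (λ u → sumMminusM L u e) (sym (U≡p a∈U)))

mainTheorem8 : (L : FinDistLattice) → (m : Fin (FinDistLattice.n L)) →
    IsMI L m → ESolvable L m
mainTheorem8 L m isMIm = (λ _ → 1 , ≤-refl) , λ _ → w , e , solvesE
  where open MeetIrreducible L isMIm
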